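{- Let $G$ be a controllable simple graph on $n$ vertices with adjacency matrix $A$ and walk matrix $W=W(G)$, let $p$ be an odd prime factor of $\det W$ with $\operatorname{rank}_p W=n-1$, and let $\tau=v_p(L(G))\ge 1$. Let $z_0$ be an integral vector with $z_0\not\equiv 0\pmod p$ and $\lambda_0$ an integer such that $z_0^{\mathsf T}z_0\equiv 0$, $z_0^{\mathsf T}Az_0\equiv 0\pmod{p^{2\tau}}$, $W^{\mathsf T}z_0\equiv 0\pmod{p^\tau}$ and $Az_0\equiv\lambda_0z_0\pmod{p^\tau}$. Let $\operatorname{diag}(f_1,\ldots,f_n)$ be the Smith normal form of $A-\lambda_0 I$ over $\mathbb{Z}$ (so $f_1\mid f_2\mid\cdots\mid f_n$). Then $f_{n-2}\not\equiv 0\pmod p$ and $f_n\equiv 0\pmod{p^\tau}$.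
   Context: $W(G)=[e,Ae,\ldots,A^{n-1}e]$ with $e$ the all-ones vector; $G$ is controllable if $\det W(G)\ne0$. $\operatorname{rank}_p$ is rank over $\mathbb{Z}/p\mathbb{Z}$. $v_p(m)$ is the largest $s\ge0$ with $p^s\mid m$. $\mathcal{Q}(G)$ is the set of rational orthogonal $n\times n$ matrices $Q$ with all row sums $1$ such that $Q^{\mathsf T}AQ$ is a $(0,1)$-matrix; $\ell(Q)$ is the least positive integer $k$ with $kQ$ integral; $L(G)=\operatorname{lcm}\{\ell(Q):Q\in\mathcal{Q}(G)\}$. Vector congruences are entrywise. -}

module Defs where

open import Data.Nat as ℕ using (ℕ; zero; suc)
open import Data.Nat.Primality using (Prime)
open import Data.Nat.Divisibility using (_∣_)
open import Data.Fin using (Fin; zero; suc; toℕ; punchIn)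
open import Data.Integer as ℤ using (ℤ; +_; -_)
open import Data.Integer.Divisibility as ℤD using ()
open import Data.Rational as ℚ using (ℚ; 0ℚ; 1ℚ; _/_)
open import Data.Product using (Σ; _×_; _,_; ∃)
open import Data.Sum using (_⊎_)
open import Relation.Binary.PropositionalEquality using (_≡_)
open import Relation.Nullary using (¬_)

Mat : ℕ → Set
Mat n = Fin n → Fin n → ℤ

Vecℤ : ℕ → Set
Vecℤ n = Fin n → ℤ

MatQ : ℕ → Set
MatQ n = Fin n → Fin n → ℚ

Σℤ : ∀ {n} → (Fin n → ℤ) → ℤ
Σℤ {zero} f = + 0
Σℤ {suc n} f = f zero ℤ.+ Σℤ (λ i → f (suc i))

Σℚ : ∀ {n} → (Fin n → ℚ) → ℚ
Σℚ {zero} f = 0ℚ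
Σℚ {suc n} f = f zero ℚ.+ Σℚ (λ i → f (suc i))

_⊛_ : ∀ {n} → Mat n → Mat n → Mat n
(M ⊛ N) i j = Σℤ (λ k → M i k ℤ.* N k j)

_·v_ : ∀ {n} → Mat n → Vecℤ n → Vecℤ n
(M ·v v) i = Σℤ (λ k → M i k ℤ.* v k)

transpose : ∀ {n} → Mat n → Mat n
transpose M i j = M j i

idMat : ∀ {n} → Mat n
idMat {suc n} zero zero = + 1
idMat {suc n} zero (suc j) = + 0
idMat {suc n} (suc i) zero = + 0
idMat {suc n} (suc i) (suc j) = idMat {n} i j

diagMat : ∀ {n} → Vecℤ n → Mat n
diagMat {suc n} f zero zero = f zero
diagMat {suc n} f zero (suc j) = + 0
diagMat {suc n} f (suc i) zero = + 0
diagMat {suc n} f (suc i) (suc j) = diagMat (λ k → f (suc k)) i j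

shift : ∀ {n} → Mat n → ℤ → Mat n
shift A λ₀ i j = A i j ℤ.- λ₀ ℤ.* idMat i j

sgn : ℕ → ℤ
sgn zero = + 1
sgn (suc k) = - sgn k

det : ∀ {n} → Mat n → ℤ
det {zero} M = + 1
det {suc n} M =
  Σℤ (λ j → sgn (toℕ j) ℤ.* (M zero j ℤ.* det {n} (λ a b → M (suc a) (punchIn j b))))

allOnes : ∀ {n} → Vecℤ n
allOnes _ = + 1

powv : ∀ {n} → Mat n → ℕ → Vecℤ n → Vecℤ n
powv A zero v = v
powv A (suc k) v = A ·v powv A k v

walkMatrix : ∀ {n} → Mat n → Mat n
walkMatrix A i k = powv A (toℕ k) allOnes i

IsAdjacency : ∀ {n} → Mat n → Set
IsAdjacency A =
  (∀ i j → (A i j ≡ + 0) ⊎ (A i j ≡ + 1)) ×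
  (∀ i j → A i j ≡ A j i) ×
  (∀ i → A i i ≡ + 0)

Controllable : ∀ {n} → Mat n → Set
Controllable A = ¬ (det (walkMatrix A) ≡ + 0)

_∣ℤ_ : ℕ → ℤ → Set
m ∣ℤ x = (+ m) ℤD.∣ x

-- Rank over ℤ/pℤ, as determinantal rank: some r×r minor is nonzero mod p and
-- every (r+1)×(r+1) minor vanishes mod p. Minors are selected by injective
-- row/column maps.
Injective : ∀ {r n} → (Fin r → Fin n) → Set
Injective f = ∀ a b → f a ≡ f b → a ≡ b

minor : ∀ {r n} → Mat n → (Fin r → Fin n) → (Fin r → Fin n) → Mat r
minor M ρ κ a b = M (ρ a) (κ b)

RankModP : ∀ {n} → ℕ → Mat n → ℕ → Set
RankModP {n} p M r =
  (Σ (Fin r → Fin n) λ ρ → Σ (Fin r → Fin n) λ κ →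
     Injective ρ × Injective κ × ¬ (p ∣ℤ det (minor M ρ κ))) ×
  (∀ (ρ κ : Fin (suc r) → Fin n) → Injective ρ → Injective κ →
     p ∣ℤ det (minor M ρ κ))

Valuation : ℕ → ℕ → ℕ → Set
Valuation p m s = ¬ (m ≡ 0) × (p ℕ.^ s) ∣ m × ¬ ((p ℕ.^ suc s) ∣ m)

toQ : ∀ {n} → Mat n → MatQ n
toQ A i j = A i j / 1

_⊛Q_ : ∀ {n} → MatQ n → MatQ n → MatQ n
(M ⊛Q N) i j = Σℚ (λ k → M i k ℚ.* N k j)

transposeQ : ∀ {n} → MatQ n → MatQ n
transposeQ M i j = M j i

idMatQ : ∀ {n} → MatQ n
idMatQ {suc n} zero zero = 1ℚ
idMatQ {suc n} zero (suc j) = 0ℚ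
idMatQ {suc n} (suc i) zero = 0ℚ
idMatQ {suc n} (suc i) (suc j) = idMatQ {n} i j

InQ : ∀ {n} → Mat n → MatQ n → Set
InQ A Q =
  (∀ i j → (transposeQ Q ⊛Q Q) i j ≡ idMatQ i j) ×
  (∀ i → Σℚ (λ j → Q i j) ≡ 1ℚ) ×
  (∀ i j → ((transposeQ Q ⊛Q (toQ A ⊛Q Q)) i j ≡ 0ℚ) ⊎
           ((transposeQ Q ⊛Q (toQ A ⊛Q Q)) i j ≡ 1ℚ))

IsIntegralQ : ℚ → Set
IsIntegralQ q = ℚ.denominatorℕ q ≡ 1

IntegralMultiple : ∀ {n} → ℕ → MatQ n → Set
IntegralMultiple k Q = ∀ i j → IsIntegralQ ((+ k / 1) ℚ.* Q i j)

Level : ∀ {n} → MatQ n → ℕ → Set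
Level Q k = (0 ℕ.< k) × IntegralMultiple k Q ×
            (∀ m → 0 ℕ.< m → IntegralMultiple m Q → k ℕ.≤ m)

IsLcmLevels : ∀ {n} → Mat n → ℕ → Set
IsLcmLevels A L =
  (∀ Q k → InQ A Q → Level Q k → k ∣ L) ×
  (∀ m → (∀ Q k → InQ A Q → Level Q k → k ∣ m) → L ∣ m)

Unimodular : ∀ {n} → Mat n → Set
Unimodular U = (det U ≡ + 1) ⊎ (det U ≡ - (+ 1))

IsSmithNormalForm : ∀ {n} → Mat n → Vecℤ n → Set
IsSmithNormalForm {n} M f =
  (Σ (Mat n) λ U → Σ (Mat n) λ V →
     Unimodular U × Unimodular V × (∀ i j → ((U ⊛ M) ⊛ V) i j ≡ diagMat f i j)) ×
  (∀ i → + 0 ℤ.≤ f i) ×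
  (∀ (i j : Fin n) → toℕ j ≡ suc (toℕ i) → f i ℤD.∣ f j)

{-# OPTIONS --safe #-}
module Submission where

-- Write U (A - λ₀I) V = diag(f) with U, V unimodular.
--
-- Putting z₀ = V y, the congruence (A - λ₀I) z₀ ≡ 0 (mod p^τ) becomes fₖ yₖ ≡ 0 for
-- every k, and some yₖ is prime to p because z₀ ≢ 0 (mod p); hence p^τ ∣ fₖ ∣ fₙ.
--
-- If p divided f_{n-2}, it would divide f_{n-1} and fₙ too, and since A is symmetric the
-- last three rows of U would lie in the kernel of A - λ₀I mod p. Two linear conditions on
-- three coefficients leave a combination y of these rows, nonzero mod p, with eᵀy ≡ 0 and
-- with y vanishing at the one row outside an (n-1)×(n-1) minor of W that is nonsingular
-- mod p. Being an eigenvector mod p, y satisfies (Aᵗe)ᵀy ≡ λ₀ᵗ eᵀy ≡ 0, i.e. Wᵀy ≡ 0, and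
-- the minor then forces y ≡ 0 (mod p), against the unimodularity of U.
--
-- The linear algebra over ℤ (inverting unimodular matrices, independence mod p of the
-- rows of a matrix whose determinant is prime to p) rests on the adjugate identity
-- M adj(M) = det M · I, derived from the first-row Laplace expansion that defines det.

open import Defs
import Data.Nat as ℕ
import Data.Nat.Properties as ℕₚ
import Data.Nat.Divisibility as ℕᵈ
open import Data.Nat.Primality using (Prime; euclidsLemma; ¬prime[1]; prime⇒nonZero)
open import Data.Fin using (Fin; zero; suc; toℕ; fromℕ<; punchIn; punchOut; _≟_)
open import Data.Fin.Properties
  using (toℕ-fromℕ<; toℕ-injective; toℕ<n; suc-injective; all?; any?; ¬∀⟶∃¬; injective⇒≤;
         punchInᵢ≢i; punchOut-cong; punchOut-injective; punchOut-punchIn; punchIn-punchOut)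
open import Data.Fin.Patterns using (0F; 1F; 2F)
open import Data.Vec.Functional using ([]; _∷_)
import Data.Integer.Divisibility as ℤᵘ
open import Data.Integer.Divisibility.Signed
  using (_∣_; divides; _∣?_; ∣ᵤ⇒∣; ∣⇒∣ᵤ; ∣-reflexive; ∣-trans;
         ∣m∣n⇒∣m+n; ∣m∣n⇒∣m-n; ∣n⇒∣m*n; ∣m⇒∣m*n; ∣m⇒∣-m)
open import Data.Product using (Σ; ∃; _×_; _,_; proj₁; proj₂)
open import Data.Sum using (_⊎_; inj₁; inj₂; [_,_]′)
open import Data.Empty using (⊥; ⊥-elim)
open import Function using (id; _∘_; _$_)
open import Relation.Binary.PropositionalEquality
open import Relation.Nullary using (¬_; Dec; yes; no)

-- The integer operators stay local to this module: the statement below uses + and * on ℕ.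
module _ where

  open import Data.Nat using (ℕ; zero; suc)
  open import Data.Integer as ℤ using (ℤ; +_; -[1+_]; -_; _+_; _*_; _-_)
  open import Data.Integer.Properties
    using (+-identityˡ; +-identityʳ; *-identityˡ; *-identityʳ; *-zeroʳ; *-comm; *-assoc; neg-involutive;
           neg-distribˡ-*; -1*i≡-i; abs-*; +-*-semiring)
  open import Data.Integer.Tactic.RingSolver using (solve-∀)
  open import Algebra.Properties.Semiring.Sum +-*-semiring
    using (sum; sum-replicate-zero; ∑-distrib-+; ∑-comm; sum-remove; *-distribˡ-sum)

  Σℤ≡sum : ∀ {n} (f : Fin n → ℤ) → Σℤ f ≡ sum f
  Σℤ≡sum {zero} f = refl
  Σℤ≡sum {suc n} f = cong (_+_ (f zero)) (Σℤ≡sum (f ∘ suc))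

  Σℤ-cong : ∀ {n} {f g : Fin n → ℤ} → f ≗ g → Σℤ f ≡ Σℤ g
  Σℤ-cong {zero} f≗g = refl
  Σℤ-cong {suc n} f≗g = cong₂ _+_ (f≗g zero) (Σℤ-cong (f≗g ∘ suc))

  Σℤ-zero : ∀ n → Σℤ {n} (λ _ → + 0) ≡ + 0
  Σℤ-zero n = trans (Σℤ≡sum {n} (λ _ → + 0)) (sum-replicate-zero n)

  Σℤ-distrib-+ : ∀ {n} (f g : Fin n → ℤ) → Σℤ (λ i → f i + g i) ≡ Σℤ f + Σℤ g
  Σℤ-distrib-+ f g = begin
    Σℤ (λ i → f i + g i)  ≡⟨ Σℤ≡sum (λ i → f i + g i) ⟩
    sum (λ i → f i + g i) ≡⟨ ∑-distrib-+ f g ⟩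
    sum f + sum g         ≡⟨ sym (cong₂ _+_ (Σℤ≡sum f) (Σℤ≡sum g)) ⟩
    Σℤ f + Σℤ g           ∎
    where open ≡-Reasoning

  *-distribˡ-Σℤ : ∀ {n} c (f : Fin n → ℤ) → c * Σℤ f ≡ Σℤ (λ i → c * f i)
  *-distribˡ-Σℤ c f = begin
    c * Σℤ f               ≡⟨ cong (c *_) (Σℤ≡sum f) ⟩
    c * sum f              ≡⟨ *-distribˡ-sum c f ⟩
    sum (λ i → c * f i)    ≡⟨ sym (Σℤ≡sum (λ i → c * f i)) ⟩
    Σℤ (λ i → c * f i)     ∎
    where open ≡-Reasoning

  *-distribʳ-Σℤ : ∀ {n} c (f : Fin n → ℤ) → Σℤ f * c ≡ Σℤ (λ i → f i * c)
  *-distribʳ-Σℤ c f = trans (*-comm (Σℤ f) c) (trans (*-distribˡ-Σℤ c f) (Σℤ-cong (λ i → *-comm c (f i))))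

  Σℤ-neg : ∀ {n} (f : Fin n → ℤ) → Σℤ (λ i → - f i) ≡ - Σℤ f
  Σℤ-neg f = begin
    Σℤ (λ i → - f i)       ≡⟨ Σℤ-cong (λ i → sym (-1*i≡-i (f i))) ⟩
    Σℤ (λ i → - + 1 * f i) ≡⟨ sym (*-distribˡ-Σℤ (- + 1) f) ⟩
    - + 1 * Σℤ f           ≡⟨ -1*i≡-i (Σℤ f) ⟩
    - Σℤ f                 ∎
    where open ≡-Reasoning

  Σℤ-comm : ∀ {m n} (f : Fin m → Fin n → ℤ) →
    Σℤ (λ i → Σℤ (λ j → f i j)) ≡ Σℤ (λ j → Σℤ (λ i → f i j))
  Σℤ-comm f = begin
    Σℤ (λ i → Σℤ (λ j → f i j))   ≡⟨ trans (Σℤ-cong (λ i → Σℤ≡sum (f i))) (Σℤ≡sum (λ i → sum (f i))) ⟩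
    sum (λ i → sum (λ j → f i j)) ≡⟨ ∑-comm f ⟩
    sum (λ j → sum (λ i → f i j)) ≡⟨ sym (trans (Σℤ-cong (λ j → Σℤ≡sum (λ i → f i j)))
                                               (Σℤ≡sum (λ j → sum (λ i → f i j)))) ⟩
    Σℤ (λ j → Σℤ (λ i → f i j))   ∎
    where open ≡-Reasoning

  Σℤ-remove : ∀ {n} (i : Fin (suc n)) (f : Fin (suc n) → ℤ) → Σℤ f ≡ f i + Σℤ (f ∘ punchIn i)
  Σℤ-remove i f = begin
    Σℤ f                   ≡⟨ Σℤ≡sum f ⟩
    sum f                  ≡⟨ sum-remove f ⟩
    f i + sum (f ∘ punchIn i) ≡⟨ cong (_+_ (f i)) (sym (Σℤ≡sum (f ∘ punchIn i))) ⟩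
    f i + Σℤ (f ∘ punchIn i) ∎
    where open ≡-Reasoning

  ∣-Σℤ : ∀ {n d} {f : Fin n → ℤ} → (∀ i → d ∣ f i) → d ∣ Σℤ f
  ∣-Σℤ {zero} _ = divides (+ 0) refl
  ∣-Σℤ {suc n} d∣f = ∣m∣n⇒∣m+n (d∣f zero) (∣-Σℤ (d∣f ∘ suc))

  idMat-sym : ∀ {n} (i j : Fin n) → idMat i j ≡ idMat j i
  idMat-sym zero    zero    = refl
  idMat-sym zero    (suc j) = refl
  idMat-sym (suc i) zero    = refl
  idMat-sym (suc i) (suc j) = idMat-sym i j

  idMat-diag : ∀ {n} (i : Fin n) → idMat i i ≡ + 1
  idMat-diag zero    = refl
  idMat-diag (suc i) = idMat-diag i

  idMat-off : ∀ {n} {i j : Fin n} → i ≢ j → idMat i j ≡ + 0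
  idMat-off {i = zero}  {zero}  i≢j = ⊥-elim (i≢j refl)
  idMat-off {i = zero}  {suc j} i≢j = refl
  idMat-off {i = suc i} {zero}  i≢j = refl
  idMat-off {i = suc i} {suc j} i≢j = idMat-off (i≢j ∘ cong suc)

  idMat-injective : ∀ {d n} {ι : Fin d → Fin n} → Injective ι → ∀ t s → idMat (ι t) (ι s) ≡ idMat t s
  idMat-injective {ι = ι} ι-inj t s with t ≟ s
  ... | yes refl = trans (idMat-diag (ι t)) (sym (idMat-diag t))
  ... | no  t≢s  = trans (idMat-off (t≢s ∘ ι-inj t s)) (sym (idMat-off t≢s))

  Σℤ-idMatˡ : ∀ {n} (i : Fin n) (g : Fin n → ℤ) → Σℤ (λ k → idMat i k * g k) ≡ g i
  Σℤ-idMatˡ {suc n} zero g = begin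
    + 1 * g zero + Σℤ (λ k → + 0 * g (suc k)) ≡⟨ cong₂ _+_ (*-identityˡ (g zero)) (Σℤ-zero n) ⟩
    g zero + + 0                              ≡⟨ +-identityʳ (g zero) ⟩
    g zero                                    ∎
    where open ≡-Reasoning
  Σℤ-idMatˡ {suc n} (suc i) g = trans (+-identityˡ _) (Σℤ-idMatˡ i (g ∘ suc))

  Σℤ-idMatʳ : ∀ {n} (i : Fin n) (g : Fin n → ℤ) → Σℤ (λ k → g k * idMat k i) ≡ g i
  Σℤ-idMatʳ i g = trans (Σℤ-cong (λ k → trans (*-comm (g k) _) (cong (_* g k) (idMat-sym k i)))) (Σℤ-idMatˡ i g)

  infix 7 _·_
  _·_ : ∀ {n} → Vecℤ n → Vecℤ n → ℤ
  u · v = Σℤ (λ t → u t * v t)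

  ·-comm : ∀ {n} (u v : Vecℤ n) → u · v ≡ v · u
  ·-comm u v = Σℤ-cong (λ t → *-comm (u t) (v t))

  ∣-·ʳ : ∀ {n d} (u : Vecℤ n) {v : Vecℤ n} → (∀ t → d ∣ v t) → d ∣ u · v
  ∣-·ʳ u d∣v = ∣-Σℤ (λ t → ∣n⇒∣m*n (u t) (d∣v t))

  ∣-·v : ∀ {n d} (P : Mat n) {v : Vecℤ n} → (∀ k → d ∣ v k) → ∀ i → d ∣ (P ·v v) i
  ∣-·v P d∣v i = ∣-·ʳ (P i) d∣v

  combination : ∀ {d n} → Vecℤ d → (Fin d → Vecℤ n) → Vecℤ n
  combination c x j = c · (λ t → x t j)

  ·-combination : ∀ {d n} (w : Vecℤ n) (c : Vecℤ d) (x : Fin d → Vecℤ n) →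
    w · combination c x ≡ c · (λ t → w · x t)
  ·-combination w c x = begin
    Σℤ (λ j → w j * Σℤ (λ t → c t * x t j))   ≡⟨ Σℤ-cong (λ j → *-distribˡ-Σℤ (w j) (λ t → c t * x t j)) ⟩
    Σℤ (λ j → Σℤ (λ t → w j * (c t * x t j))) ≡⟨ Σℤ-comm (λ j t → w j * (c t * x t j)) ⟩
    Σℤ (λ t → Σℤ (λ j → w j * (c t * x t j))) ≡⟨ Σℤ-cong (λ t → Σℤ-cong (λ j → swap (w j) (c t) (x t j))) ⟩
    Σℤ (λ t → Σℤ (λ j → c t * (w j * x t j))) ≡⟨ Σℤ-cong (λ t → sym (*-distribˡ-Σℤ (c t) (λ j → w j * x t j))) ⟩
    Σℤ (λ t → c t * Σℤ (λ j → w j * x t j))   ∎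
    where
    open ≡-Reasoning
    swap : ∀ w c x → w * (c * x) ≡ c * (w * x)
    swap = solve-∀

  ·v-assoc : ∀ {n} (P Q : Mat n) (v : Vecℤ n) i → ((P ⊛ Q) ·v v) i ≡ (P ·v (Q ·v v)) i
  ·v-assoc P Q v i = begin
    Σℤ (λ k → Σℤ (λ l → P i l * Q l k) * v k) ≡⟨ Σℤ-cong (λ k → *-distribʳ-Σℤ (v k) (λ l → P i l * Q l k)) ⟩
    Σℤ (λ k → Σℤ (λ l → P i l * Q l k * v k)) ≡⟨ Σℤ-comm (λ k l → P i l * Q l k * v k) ⟩
    Σℤ (λ l → Σℤ (λ k → P i l * Q l k * v k)) ≡⟨ Σℤ-cong (λ l → Σℤ-cong (λ k → *-assoc (P i l) (Q l k) (v k))) ⟩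
    Σℤ (λ l → Σℤ (λ k → P i l * (Q l k * v k))) ≡⟨ Σℤ-cong (λ l → sym (*-distribˡ-Σℤ (P i l) (λ k → Q l k * v k))) ⟩
    Σℤ (λ l → P i l * Σℤ (λ k → Q l k * v k)) ∎
    where open ≡-Reasoning

  ⊛-assoc : ∀ {n} (P Q R : Mat n) i j → ((P ⊛ Q) ⊛ R) i j ≡ (P ⊛ (Q ⊛ R)) i j
  ⊛-assoc P Q R i j = ·v-assoc P Q (λ k → R k j) i

  ·v-symmetric : ∀ {n} (A : Mat n) → (∀ i j → A i j ≡ A j i) → (u y : Vecℤ n) → (A ·v u) · y ≡ u · (A ·v y)
  ·v-symmetric A A-sym u y = begin
    Σℤ (λ k → Σℤ (λ j → A k j * u j) * y k)   ≡⟨ Σℤ-cong (λ k → *-distribʳ-Σℤ (y k) (λ j → A k j * u j)) ⟩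
    Σℤ (λ k → Σℤ (λ j → A k j * u j * y k))   ≡⟨ Σℤ-comm (λ k j → A k j * u j * y k) ⟩
    Σℤ (λ j → Σℤ (λ k → A k j * u j * y k))   ≡⟨ Σℤ-cong (λ j → Σℤ-cong (λ k →
                                                    trans (cong (λ a → a * u j * y k) (A-sym k j)) (swap (A j k) (u j) (y k)))) ⟩
    Σℤ (λ j → Σℤ (λ k → u j * (A j k * y k))) ≡⟨ Σℤ-cong (λ j → sym (*-distribˡ-Σℤ (u j) (λ k → A j k * y k))) ⟩
    Σℤ (λ j → u j * Σℤ (λ k → A j k * y k))   ∎
    where
    open ≡-Reasoning
    swap : ∀ a u y → a * u * y ≡ u * (a * y)
    swap = solve-∀

  diagMat-idMat : ∀ {n} (f : Vecℤ n) i j → diagMat f i j ≡ f i * idMat i j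
  diagMat-idMat f zero    zero    = sym (*-identityʳ (f zero))
  diagMat-idMat f zero    (suc j) = sym (*-zeroʳ (f zero))
  diagMat-idMat f (suc i) zero    = sym (*-zeroʳ (f (suc i)))
  diagMat-idMat f (suc i) (suc j) = diagMat-idMat (f ∘ suc) i j

  diagMat-·v : ∀ {n} (f y : Vecℤ n) i → (diagMat f ·v y) i ≡ f i * y i
  diagMat-·v f y i = begin
    Σℤ (λ k → diagMat f i k * y k)      ≡⟨ Σℤ-cong (λ k → cong (_* y k) (diagMat-idMat f i k)) ⟩
    Σℤ (λ k → f i * idMat i k * y k)    ≡⟨ Σℤ-cong (λ k → *-assoc (f i) (idMat i k) (y k)) ⟩
    Σℤ (λ k → f i * (idMat i k * y k))  ≡⟨ sym (*-distribˡ-Σℤ (f i) (λ k → idMat i k * y k)) ⟩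
    f i * Σℤ (λ k → idMat i k * y k)    ≡⟨ cong (f i *_) (Σℤ-idMatˡ i y) ⟩
    f i * y i                           ∎
    where open ≡-Reasoning

  shift-·v : ∀ {n} (A : Mat n) λ₀ (z : Vecℤ n) i → (shift A λ₀ ·v z) i ≡ (A ·v z) i - λ₀ * z i
  shift-·v A λ₀ z i = begin
    Σℤ (λ k → (A i k - λ₀ * idMat i k) * z k)
      ≡⟨ Σℤ-cong (λ k → distrib (A i k) λ₀ (idMat i k) (z k)) ⟩
    Σℤ (λ k → A i k * z k + - (λ₀ * (idMat i k * z k)))
      ≡⟨ Σℤ-distrib-+ (λ k → A i k * z k) (λ k → - (λ₀ * (idMat i k * z k))) ⟩
    (A ·v z) i + Σℤ (λ k → - (λ₀ * (idMat i k * z k)))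
      ≡⟨ cong (_+_ ((A ·v z) i)) (Σℤ-neg (λ k → λ₀ * (idMat i k * z k))) ⟩
    (A ·v z) i - Σℤ (λ k → λ₀ * (idMat i k * z k))
      ≡⟨ cong (_-_ ((A ·v z) i)) (sym (*-distribˡ-Σℤ λ₀ (λ k → idMat i k * z k))) ⟩
    (A ·v z) i - λ₀ * Σℤ (λ k → idMat i k * z k)
      ≡⟨ cong (λ s → (A ·v z) i - λ₀ * s) (Σℤ-idMatˡ i z) ⟩
    (A ·v z) i - λ₀ * z i
      ∎
    where
    open ≡-Reasoning
    distrib : ∀ a l d x → (a - l * d) * x ≡ a * x + - (l * (d * x))
    distrib = solve-∀

  shift-sym : ∀ {n} (A : Mat n) λ₀ → (∀ i j → A i j ≡ A j i) → ∀ i j → shift A λ₀ i j ≡ shift A λ₀ j i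
  shift-sym A λ₀ A-sym i j = cong₂ (λ a d → a - λ₀ * d) (A-sym i j) (idMat-sym i j)

  sg : ∀ {n} → Fin n → ℤ
  sg j = sgn (toℕ j)

  sg-square : ∀ {n} (j : Fin n) → sg j * sg j ≡ + 1
  sg-square j = go (toℕ j)
    where
    go : ∀ m → sgn m * sgn m ≡ + 1
    go zero    = refl
    go (suc m) = trans (neg-square (sgn m)) (go m)
      where
      neg-square : ∀ x → (- x) * (- x) ≡ x * x
      neg-square = solve-∀

  minorAt : ∀ {n} → Mat (suc n) → Fin (suc n) → Fin (suc n) → Mat n
  minorAt M i j a b = M (punchIn i a) (punchIn j b)

  det-cong : ∀ {n} {M N : Mat n} → (∀ i j → M i j ≡ N i j) → det M ≡ det N
  det-cong {zero}  M≡N = refl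
  det-cong {suc n} M≡N = Σℤ-cong (λ j →
    cong₂ (λ x d → sg j * (x * d)) (M≡N zero j) (det-cong (λ a b → M≡N (suc a) (punchIn j b))))

  swap01 : ∀ {n} → Mat (suc (suc n)) → Mat (suc (suc n))
  swap01 M zero          = M (suc zero)
  swap01 M (suc zero)    = M zero
  swap01 M (suc (suc i)) = M (suc (suc i))

  twoRowTerm : ∀ {n} → Mat (suc (suc n)) → Fin (suc (suc n)) → Fin (suc n) → ℤ
  twoRowTerm M c l = sg c * (M zero c * (sg l * (M (suc zero) (punchIn c l) * det (minorAt (minorAt M zero c) zero l))))

  det-twoRowTerms : ∀ {n} (M : Mat (suc (suc n))) → det M ≡ Σℤ (λ c → Σℤ (twoRowTerm M c))
  det-twoRowTerms M = Σℤ-cong (λ c → begin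
    sg c * (M zero c * Σℤ (g c))               ≡⟨ cong (sg c *_) (*-distribˡ-Σℤ (M zero c) (g c)) ⟩
    sg c * Σℤ (λ l → M zero c * g c l)         ≡⟨ *-distribˡ-Σℤ (sg c) (λ l → M zero c * g c l) ⟩
    Σℤ (twoRowTerm M c)                        ∎)
    where
    open ≡-Reasoning
    g : ∀ c l → ℤ
    g c l = sg l * (M (suc zero) (punchIn c l) * det (minorAt (minorAt M zero c) zero l))

  -- Reindexing the second column by punchOut makes the expansion along the
  -- first two rows a sum over all pairs (c , d) of columns.
  pairTerm : ∀ {n} → Mat (suc (suc n)) → Fin (suc (suc n)) → Fin (suc (suc n)) → ℤ
  pairTerm M c d with c ≟ d
  ... | yes _   = + 0
  ... | no c≢d  = twoRowTerm M c (punchOut c≢d)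

  pairTerm-diag : ∀ {n} (M : Mat (suc (suc n))) c → pairTerm M c c ≡ + 0
  pairTerm-diag M c with c ≟ c
  ... | yes _   = refl
  ... | no c≢c  = ⊥-elim (c≢c refl)

  pairTerm-punchIn : ∀ {n} (M : Mat (suc (suc n))) c l → pairTerm M c (punchIn c l) ≡ twoRowTerm M c l
  pairTerm-punchIn M c l with c ≟ punchIn c l
  ... | yes c≡c+l = ⊥-elim (punchInᵢ≢i c l (sym c≡c+l))
  ... | no c≢c+l  = cong (twoRowTerm M c) (trans (punchOut-cong c refl) (punchOut-punchIn c))

  det-pairTerms : ∀ {n} (M : Mat (suc (suc n))) → det M ≡ Σℤ (λ c → Σℤ (pairTerm M c))
  det-pairTerms M = trans (det-twoRowTerms M) (Σℤ-cong (λ c → sym (begin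
    Σℤ (pairTerm M c)                                   ≡⟨ Σℤ-remove c (pairTerm M c) ⟩
    pairTerm M c c + Σℤ (pairTerm M c ∘ punchIn c)      ≡⟨ cong₂ _+_ (pairTerm-diag M c) (Σℤ-cong (pairTerm-punchIn M c)) ⟩
    + 0 + Σℤ (twoRowTerm M c)                           ≡⟨ +-identityˡ _ ⟩
    Σℤ (twoRowTerm M c)                                 ∎)))
    where open ≡-Reasoning

  punchIn-punchOut-comm : ∀ {n} {c d : Fin (suc (suc n))} (c≢d : c ≢ d) (d≢c : d ≢ c) (y : Fin n) →
    punchIn c (punchIn (punchOut c≢d) y) ≡ punchIn d (punchIn (punchOut d≢c) y)
  punchIn-punchOut-comm {c = zero}  {zero}  c≢d d≢c y = ⊥-elim (c≢d refl)
  punchIn-punchOut-comm {c = zero}  {suc d} c≢d d≢c y = refl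
  punchIn-punchOut-comm {c = suc c} {zero}  c≢d d≢c y = refl
  punchIn-punchOut-comm {suc n} {suc c} {suc d} c≢d d≢c zero    = refl
  punchIn-punchOut-comm {suc n} {suc c} {suc d} c≢d d≢c (suc y) =
    cong suc (punchIn-punchOut-comm (c≢d ∘ cong suc) (d≢c ∘ cong suc) y)

  sg-punchOut-anti : ∀ {n} {c d : Fin (suc (suc n))} (c≢d : c ≢ d) (d≢c : d ≢ c) →
    sg c * sg (punchOut c≢d) ≡ - (sg d * sg (punchOut d≢c))
  sg-punchOut-anti {c = zero}  {zero}  c≢d d≢c = ⊥-elim (c≢d refl)
  sg-punchOut-anti {c = zero}  {suc d} c≢d d≢c = lemma (sg d)
    where
    lemma : ∀ x → + 1 * x ≡ - ((- x) * + 1)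
    lemma = solve-∀
  sg-punchOut-anti {c = suc c} {zero}  c≢d d≢c = lemma (sg c)
    where
    lemma : ∀ x → (- x) * + 1 ≡ - (+ 1 * x)
    lemma = solve-∀
  sg-punchOut-anti {zero}  {suc zero} {suc zero} c≢d d≢c = ⊥-elim (c≢d refl)
  sg-punchOut-anti {suc n} {suc c}    {suc d}    c≢d d≢c =
    lemma (sg c) _ (sg d) _ (sg-punchOut-anti (c≢d ∘ cong suc) (d≢c ∘ cong suc))
    where
    lemma : ∀ a b c d → a * b ≡ - (c * d) → (- a) * (- b) ≡ - ((- c) * (- d))
    lemma a b c d ab≡-cd = trans (neg-neg a b) (trans ab≡-cd (cong -_ (sym (neg-neg c d))))
      where
      neg-neg : ∀ a b → (- a) * (- b) ≡ a * b
      neg-neg = solve-∀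

  pairTerm-swap01 : ∀ {n} (M : Mat (suc (suc n))) c d → pairTerm (swap01 M) c d ≡ - pairTerm M d c
  pairTerm-swap01 M c d with c ≟ d | d ≟ c
  ... | yes _   | yes _   = refl
  ... | yes c≡d | no d≢c  = ⊥-elim (d≢c (sym c≡d))
  ... | no c≢d  | yes d≡c = ⊥-elim (c≢d (sym d≡c))
  ... | no c≢d  | no d≢c  = begin
    sg c * (M (suc zero) c * (sg (punchOut c≢d) * (M zero (punchIn c (punchOut c≢d)) * det R₁)))
      ≡⟨ cong₂ (λ x r → sg c * (M (suc zero) c * (sg (punchOut c≢d) * (M zero x * r))))
               (punchIn-punchOut c≢d) (det-cong (λ x y → cong (M (suc (suc x))) (punchIn-punchOut-comm c≢d d≢c y))) ⟩
    sg c * (M (suc zero) c * (sg (punchOut c≢d) * (M zero d * det R₂)))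
      ≡⟨ rearrange (sg c) (sg (punchOut c≢d)) (sg d) (sg (punchOut d≢c)) (M (suc zero) c) (M zero d) (det R₂)
                   (sg-punchOut-anti c≢d d≢c) ⟩
    - (sg d * (M zero d * (sg (punchOut d≢c) * (M (suc zero) c * det R₂))))
      ≡⟨ cong (λ x → - (sg d * (M zero d * (sg (punchOut d≢c) * (M (suc zero) x * det R₂))))) (sym (punchIn-punchOut d≢c)) ⟩
    - (sg d * (M zero d * (sg (punchOut d≢c) * (M (suc zero) (punchIn d (punchOut d≢c)) * det R₂)))) ∎
    where
    open ≡-Reasoning
    R₁ R₂ : Mat _
    R₁ = minorAt (minorAt M zero c) zero (punchOut c≢d)
    R₂ = minorAt (minorAt M zero d) zero (punchOut d≢c)
    rearrange : ∀ a b a′ b′ x y r → a * b ≡ - (a′ * b′) → a * (x * (b * (y * r))) ≡ - (a′ * (y * (b′ * (x * r))))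
    rearrange a b a′ b′ x y r ab≡-a′b′ = begin
      a * (x * (b * (y * r)))      ≡⟨ regroup a b x y r ⟩
      a * b * (x * y * r)          ≡⟨ cong (_* (x * y * r)) ab≡-a′b′ ⟩
      - (a′ * b′) * (x * y * r)    ≡⟨ ungroup a′ b′ x y r ⟩
      - (a′ * (y * (b′ * (x * r)))) ∎
      where
      regroup : ∀ a b x y r → a * (x * (b * (y * r))) ≡ a * b * (x * y * r)
      regroup = solve-∀
      ungroup : ∀ a b x y r → - (a * b) * (x * y * r) ≡ - (a * (y * (b * (x * r))))
      ungroup = solve-∀

  det-swap01 : ∀ {n} (M : Mat (suc (suc n))) → det (swap01 M) ≡ - det M
  det-swap01 M = begin
    det (swap01 M)                              ≡⟨ det-pairTerms (swap01 M) ⟩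
    Σℤ (λ c → Σℤ (pairTerm (swap01 M) c))       ≡⟨ Σℤ-cong (λ c → Σℤ-cong (pairTerm-swap01 M c)) ⟩
    Σℤ (λ c → Σℤ (λ d → - pairTerm M d c))      ≡⟨ Σℤ-cong (λ c → Σℤ-neg (λ d → pairTerm M d c)) ⟩
    Σℤ (λ c → - Σℤ (λ d → pairTerm M d c))      ≡⟨ Σℤ-neg (λ c → Σℤ (λ d → pairTerm M d c)) ⟩
    - Σℤ (λ c → Σℤ (λ d → pairTerm M d c))      ≡⟨ cong -_ (Σℤ-comm (λ c d → pairTerm M d c)) ⟩
    - Σℤ (λ d → Σℤ (pairTerm M d))              ≡⟨ cong -_ (sym (det-pairTerms M)) ⟩
    - det M                                     ∎
    where open ≡-Reasoning

  toTop : ∀ {n} → Fin (suc n) → Fin (suc n) → Fin (suc n)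
  toTop a zero    = a
  toTop a (suc x) = punchIn a x

  rowToTop : ∀ {n} → Fin (suc n) → Mat (suc n) → Mat (suc n)
  rowToTop a M x = M (toTop a x)

  det-rowToTop : ∀ {n} (a : Fin (suc n)) (M : Mat (suc n)) → det (rowToTop a M) ≡ sg a * det M
  det-rowToTop zero M = trans (det-cong rowToTop-zero) (sym (*-identityˡ (det M)))
    where
    rowToTop-zero : ∀ x y → rowToTop zero M x y ≡ M x y
    rowToTop-zero zero    y = refl
    rowToTop-zero (suc x) y = refl
  det-rowToTop {suc n} (suc a) M = begin
    det (rowToTop (suc a) M)                                 ≡⟨ sym (neg-involutive _) ⟩
    - - det (rowToTop (suc a) M)                             ≡⟨ cong -_ (sym (det-swap01 (rowToTop (suc a) M))) ⟩
    - det (swap01 (rowToTop (suc a) M))                      ≡⟨ cong -_ (det-cong swapped) ⟩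
    - det N                                                  ≡⟨ cong -_ (Σℤ-cong (λ j → cong (λ d → sg j * (M zero j * d))
                                                                  (det-rowToTop a (minorAt M zero j)))) ⟩
    - Σℤ (λ j → sg j * (M zero j * (sg a * det (minorAt M zero j))))
      ≡⟨ cong -_ (Σℤ-cong (λ j → pull (sg j) (M zero j) (sg a) (det (minorAt M zero j)))) ⟩
    - Σℤ (λ j → sg a * (sg j * (M zero j * det (minorAt M zero j))))
      ≡⟨ cong -_ (sym (*-distribˡ-Σℤ (sg a) (λ j → sg j * (M zero j * det (minorAt M zero j))))) ⟩
    - (sg a * det M)                                         ≡⟨ neg-distribˡ-* (sg a) (det M) ⟩
    (- sg a) * det M                                         ∎
    where
    open ≡-Reasoning
    N : Mat (suc (suc n))
    N zero    = M zero
    N (suc x) = M (suc (toTop a x))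
    swapped : ∀ x y → swap01 (rowToTop (suc a) M) x y ≡ N x y
    swapped zero             y = refl
    swapped (suc zero)       y = refl
    swapped (suc (suc x))    y = refl
    pull : ∀ s m t d → s * (m * (t * d)) ≡ t * (s * (m * d))
    pull = solve-∀

  cofactor : ∀ {n} → Mat (suc n) → Fin (suc n) → Fin (suc n) → ℤ
  cofactor M i j = sg i * (sg j * det (minorAt M i j))

  det-via-rowToTop : ∀ {n} (a : Fin (suc n)) (M : Mat (suc n)) → det M ≡ sg a * det (rowToTop a M)
  det-via-rowToTop a M = begin
    det M                     ≡⟨ sym (*-identityˡ (det M)) ⟩
    + 1 * det M               ≡⟨ cong (_* det M) (sym (sg-square a)) ⟩
    sg a * sg a * det M       ≡⟨ *-assoc (sg a) (sg a) (det M) ⟩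
    sg a * (sg a * det M)     ≡⟨ cong (sg a *_) (sym (det-rowToTop a M)) ⟩
    sg a * det (rowToTop a M) ∎
    where open ≡-Reasoning

  det-expand : ∀ {n} (M : Mat (suc n)) (i : Fin (suc n)) → det M ≡ Σℤ (λ j → M i j * cofactor M i j)
  det-expand M i = begin
    det M                                                    ≡⟨ det-via-rowToTop i M ⟩
    sg i * det (rowToTop i M)                                ≡⟨ *-distribˡ-Σℤ (sg i) (λ j → sg j * (M i j * det (minorAt M i j))) ⟩
    Σℤ (λ j → sg i * (sg j * (M i j * det (minorAt M i j)))) ≡⟨ Σℤ-cong (λ j → pull (sg i) (sg j) (M i j) (det (minorAt M i j))) ⟩
    Σℤ (λ j → M i j * cofactor M i j)                        ∎
    where
    open ≡-Reasoning
    pull : ∀ s t m d → s * (t * (m * d)) ≡ m * (s * (t * d))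
    pull = solve-∀

  i≡-i⇒i≡0 : ∀ {x : ℤ} → x ≡ - x → x ≡ + 0
  i≡-i⇒i≡0 {+ zero}    _  = refl
  i≡-i⇒i≡0 {+ suc n}   ()
  i≡-i⇒i≡0 { -[1+ n ]} ()

  det-row0≡row1 : ∀ {n} (M : Mat (suc (suc n))) → M zero ≗ M (suc zero) → det M ≡ + 0
  det-row0≡row1 M row0≗row1 = i≡-i⇒i≡0 (trans (det-cong swap01-id) (det-swap01 M))
    where
    swap01-id : ∀ x y → M x y ≡ swap01 M x y
    swap01-id zero          y = row0≗row1 y
    swap01-id (suc zero)    y = sym (row0≗row1 y)
    swap01-id (suc (suc x)) y = refl

  det-row0≡row : ∀ {n} (M : Mat (suc (suc n))) (a : Fin (suc n)) → M zero ≗ M (suc a) → det M ≡ + 0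
  det-row0≡row M a row0≗rowa = begin
    det M                                 ≡⟨ det-via-rowToTop (suc a) M ⟩
    sg (suc a) * det (rowToTop (suc a) M) ≡⟨ cong (sg (suc a) *_) (det-row0≡row1 (rowToTop (suc a) M) (sym ∘ row0≗rowa)) ⟩
    sg (suc a) * + 0                      ≡⟨ *-zeroʳ (sg (suc a)) ⟩
    + 0                                   ∎
    where open ≡-Reasoning

  det-equal-rows : ∀ {n} (M : Mat n) {i i′ : Fin n} → i ≢ i′ → M i ≗ M i′ → det M ≡ + 0
  det-equal-rows M {zero}  {zero}   i≢i′ _ = ⊥-elim (i≢i′ refl)
  det-equal-rows {suc (suc n)} M {zero}  {suc a} _ rows≗ = det-row0≡row M a rows≗
  det-equal-rows {suc (suc n)} M {suc i} {zero}  _ rows≗ = det-row0≡row M i (sym ∘ rows≗)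
  det-equal-rows {suc n} M {suc i} {suc a} i≢i′ rows≗ = begin
    det M                                          ≡⟨ Σℤ-cong (λ j → cong (λ d → sg j * (M zero j * d))
                                                        (det-equal-rows (minorAt M zero j) (i≢i′ ∘ cong suc) (rows≗ ∘ punchIn j))) ⟩
    Σℤ (λ j → sg j * (M zero j * + 0))             ≡⟨ Σℤ-cong (λ j →
                                                        trans (cong (sg j *_) (*-zeroʳ (M zero j))) (*-zeroʳ (sg j))) ⟩
    Σℤ {suc n} (λ _ → + 0)                         ≡⟨ Σℤ-zero (suc n) ⟩
    + 0                                            ∎
    where open ≡-Reasoning

  replaceRow : ∀ {n} → Mat n → Fin n → Fin n → Mat n
  replaceRow M a i x with x ≟ a
  ... | yes _ = M i
  ... | no  _ = M x

  replaceRow-at : ∀ {n} (M : Mat n) a i → replaceRow M a i a ≡ M i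
  replaceRow-at M a i with a ≟ a
  ... | yes _   = refl
  ... | no a≢a  = ⊥-elim (a≢a refl)

  replaceRow-off : ∀ {n} (M : Mat n) a i {x} → x ≢ a → replaceRow M a i x ≡ M x
  replaceRow-off M a i {x} x≢a with x ≟ a
  ... | yes x≡a = ⊥-elim (x≢a x≡a)
  ... | no  _   = refl

  -- Row i against the cofactors of row a is the expansion of M with row a
  -- replaced by row i, which has two equal rows unless i ≡ a.
  Σℤ-*-cofactor : ∀ {n} (M : Mat (suc n)) i a → Σℤ (λ j → M i j * cofactor M a j) ≡ det M * idMat i a
  Σℤ-*-cofactor M i a with i ≟ a
  ... | yes refl = begin
    Σℤ (λ j → M i j * cofactor M i j) ≡⟨ sym (det-expand M i) ⟩
    det M                             ≡⟨ sym (*-identityʳ (det M)) ⟩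
    det M * + 1                       ≡⟨ cong (det M *_) (sym (idMat-diag i)) ⟩
    det M * idMat i i                 ∎
    where open ≡-Reasoning
  ... | no i≢a = begin
    Σℤ (λ j → M i j * cofactor M a j)   ≡⟨ Σℤ-cong (λ j → cong₂ _*_ (cong (_$ j) (sym (replaceRow-at M a i)))
                                              (cong (λ d → sg a * (sg j * d)) (det-cong (λ x y →
                                                cong (_$ punchIn j y) (sym (replaceRow-off M a i (punchInᵢ≢i a x))))))) ⟩
    Σℤ (λ j → M′ a j * cofactor M′ a j) ≡⟨ sym (det-expand M′ a) ⟩
    det M′                              ≡⟨ det-equal-rows M′ i≢a (λ y → cong (_$ y)
                                             (trans (replaceRow-off M a i i≢a) (sym (replaceRow-at M a i)))) ⟩
    + 0                                 ≡⟨ sym (*-zeroʳ (det M)) ⟩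
    det M * + 0                         ≡⟨ cong (det M *_) (sym (idMat-off i≢a)) ⟩
    det M * idMat i a                   ∎
    where
    open ≡-Reasoning
    M′ = replaceRow M a i

  -- det V · adj V, the inverse of V when det V = ± 1.
  inverse : ∀ {n} → Mat (suc n) → Mat (suc n)
  inverse V j a = det V * cofactor V a j

  unimodular-det² : ∀ {n} {V : Mat n} → Unimodular V → det V * det V ≡ + 1
  unimodular-det² (inj₁ det≡1)  rewrite det≡1  = refl
  unimodular-det² (inj₂ det≡-1) rewrite det≡-1 = refl

  ⊛-inverseʳ : ∀ {n} {V : Mat (suc n)} → Unimodular V → ∀ i a → (V ⊛ inverse V) i a ≡ idMat i a
  ⊛-inverseʳ {V = V} unimodular i a = begin
    Σℤ (λ j → V i j * (det V * cofactor V a j)) ≡⟨ Σℤ-cong (λ j → swap (V i j) (det V) (cofactor V a j)) ⟩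
    Σℤ (λ j → det V * (V i j * cofactor V a j)) ≡⟨ sym (*-distribˡ-Σℤ (det V) (λ j → V i j * cofactor V a j)) ⟩
    det V * Σℤ (λ j → V i j * cofactor V a j)   ≡⟨ cong (det V *_) (Σℤ-*-cofactor V i a) ⟩
    det V * (det V * idMat i a)                 ≡⟨ sym (*-assoc (det V) (det V) (idMat i a)) ⟩
    det V * det V * idMat i a                   ≡⟨ cong (_* idMat i a) (unimodular-det² {V = V} unimodular) ⟩
    + 1 * idMat i a                             ≡⟨ *-identityˡ (idMat i a) ⟩
    idMat i a                                   ∎
    where
    open ≡-Reasoning
    swap : ∀ x d c → x * (d * c) ≡ d * (x * c)
    swap = solve-∀

  ·v-inverse : ∀ {n} {V : Mat (suc n)} → Unimodular V → ∀ z i → (V ·v (inverse V ·v z)) i ≡ z i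
  ·v-inverse {V = V} V-uni z i = begin
    (V ·v (inverse V ·v z)) i                 ≡⟨ sym (·v-assoc V (inverse V) z i) ⟩
    Σℤ (λ k → (V ⊛ inverse V) i k * z k)      ≡⟨ Σℤ-cong (λ k → cong (_* z k) (⊛-inverseʳ {V = V} V-uni i k)) ⟩
    Σℤ (λ k → idMat i k * z k)                ≡⟨ Σℤ-idMatˡ i z ⟩
    z i                                       ∎
    where open ≡-Reasoning

  prime∣*⇒∣⊎∣ : ∀ {p} → Prime p → ∀ a b → + p ∣ a * b → + p ∣ a ⊎ + p ∣ b
  prime∣*⇒∣⊎∣ p-prime a b p∣ab
    with euclidsLemma ℤ.∣ a ∣ ℤ.∣ b ∣ p-prime (ℕᵈ.∣-trans (∣⇒∣ᵤ p∣ab) (ℕᵈ.∣-reflexive (abs-* a b)))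
  ... | inj₁ p∣a = inj₁ (∣ᵤ⇒∣ p∣a)
  ... | inj₂ p∣b = inj₂ (∣ᵤ⇒∣ p∣b)

  prime∤1 : ∀ {p} → Prime p → ¬ + p ∣ + 1
  prime∤1 p-prime p∣1 = ¬prime[1] (subst Prime (ℕᵈ.∣1⇒≡1 (∣⇒∣ᵤ p∣1)) p-prime)

  prime∤unimodular : ∀ {n p} {V : Mat n} → Prime p → Unimodular V → ¬ + p ∣ det V
  prime∤unimodular p-prime (inj₁ det≡1)  p∣det = prime∤1 p-prime (subst (_ ∣_) det≡1 p∣det)
  prime∤unimodular p-prime (inj₂ det≡-1) p∣det = prime∤1 p-prime (subst (_ ∣_) (cong -_ det≡-1) (∣m⇒∣-m p∣det))

  prime-pow∣*⇒pow∣ : ∀ {p m n} → Prime p → ¬ p ℕᵈ.∣ n → ∀ t → p ℕ.^ t ℕᵈ.∣ m ℕ.* n → p ℕ.^ t ℕᵈ.∣ m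
  prime-pow∣*⇒pow∣ {p} {m} {n} p-prime p∤n zero _ = ℕᵈ.1∣ m
  prime-pow∣*⇒pow∣ {p} {m} {n} p-prime p∤n (suc t) pᵗ⁺¹∣mn
    with euclidsLemma m n p-prime (ℕᵈ.∣-trans (ℕᵈ.m∣m*n (p ℕ.^ t)) pᵗ⁺¹∣mn)
  ... | inj₂ p∣n = ⊥-elim (p∤n p∣n)
  ... | inj₁ (ℕᵈ.divides-refl q) = subst (ℕᵈ._∣ q ℕ.* p) (ℕₚ.*-comm (p ℕ.^ t) p) (ℕᵈ.*-monoˡ-∣ p pᵗ∣q)
    where
    instance _ = prime⇒nonZero p-prime
    pᵗ∣qn : p ℕ.^ t ℕᵈ.∣ q ℕ.* n
    pᵗ∣qn = ℕᵈ.*-cancelʳ-∣ p (subst₂ ℕᵈ._∣_ (ℕₚ.*-comm p (p ℕ.^ t)) (shuffle q p n) pᵗ⁺¹∣mn)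
      where
      shuffle : ∀ q p n → q ℕ.* p ℕ.* n ≡ q ℕ.* n ℕ.* p
      shuffle q p n = trans (ℕₚ.*-assoc q p n) (trans (cong (q ℕ.*_) (ℕₚ.*-comm p n)) (sym (ℕₚ.*-assoc q n p)))
    pᵗ∣q : p ℕ.^ t ℕᵈ.∣ q
    pᵗ∣q = prime-pow∣*⇒pow∣ p-prime p∤n t pᵗ∣qn

  prime-pow∣*⇒pow∣ℤ : ∀ {p} → Prime p → ∀ t a b → + (p ℕ.^ t) ∣ a * b → ¬ + p ∣ b → + (p ℕ.^ t) ∣ a
  prime-pow∣*⇒pow∣ℤ p-prime t a b pᵗ∣ab p∤b = ∣ᵤ⇒∣ (prime-pow∣*⇒pow∣ p-prime (p∤b ∘ ∣ᵤ⇒∣) t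
    (ℕᵈ.∣-trans (∣⇒∣ᵤ pᵗ∣ab) (ℕᵈ.∣-reflexive (abs-* a b))))

  -- Multiplying c N ≡ 0 by the adjugate of N gives c · det N ≡ 0.
  rows-independent : ∀ {n p} → Prime p → (N : Mat n) → ¬ + p ∣ det N → (c : Vecℤ n) →
    (∀ b → + p ∣ Σℤ (λ a → c a * N a b)) → ∀ a → + p ∣ c a
  rows-independent {zero} p-prime N p∤det c p∣cN ()
  rows-independent {suc n} {p} p-prime N p∤det c p∣cN a₀ =
    [ id , ⊥-elim ∘ p∤det ]′ (prime∣*⇒∣⊎∣ p-prime (c a₀) (det N) (subst (_ ∣_) expansion p∣Σ))
    where
    g : Fin _ → ℤ
    g b = Σℤ (λ a → c a * N a b) * cofactor N a₀ b
    p∣Σ : + p ∣ Σℤ g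
    p∣Σ = ∣-Σℤ (λ b → ∣m⇒∣m*n (cofactor N a₀ b) (p∣cN b))
    expansion : Σℤ g ≡ c a₀ * det N
    expansion = begin
      Σℤ (λ b → Σℤ (λ a → c a * N a b) * cofactor N a₀ b)
        ≡⟨ Σℤ-cong (λ b → *-distribʳ-Σℤ (cofactor N a₀ b) (λ a → c a * N a b)) ⟩
      Σℤ (λ b → Σℤ (λ a → c a * N a b * cofactor N a₀ b))
        ≡⟨ Σℤ-comm (λ b a → c a * N a b * cofactor N a₀ b) ⟩
      Σℤ (λ a → Σℤ (λ b → c a * N a b * cofactor N a₀ b))
        ≡⟨ Σℤ-cong (λ a → Σℤ-cong (λ b → *-assoc (c a) (N a b) (cofactor N a₀ b))) ⟩
      Σℤ (λ a → Σℤ (λ b → c a * (N a b * cofactor N a₀ b)))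
        ≡⟨ Σℤ-cong (λ a → sym (*-distribˡ-Σℤ (c a) (λ b → N a b * cofactor N a₀ b))) ⟩
      Σℤ (λ a → c a * Σℤ (λ b → N a b * cofactor N a₀ b))
        ≡⟨ Σℤ-cong (λ a → cong (c a *_) (Σℤ-*-cofactor N a a₀)) ⟩
      Σℤ (λ a → c a * (det N * idMat a a₀))
        ≡⟨ Σℤ-cong (λ a → sym (*-assoc (c a) (det N) (idMat a a₀))) ⟩
      Σℤ (λ a → c a * det N * idMat a a₀)
        ≡⟨ Σℤ-idMatʳ a₀ (λ a → c a * det N) ⟩
      c a₀ * det N
        ∎
      where open ≡-Reasoning

  NonzeroMod : ℕ → ∀ {n} → Vecℤ n → Set
  NonzeroMod p v = ¬ (∀ t → + p ∣ v t)

  nonzeroMod? : ∀ p {n} (v : Vecℤ n) → NonzeroMod p v ⊎ (∀ t → + p ∣ v t)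
  nonzeroMod? p v with all? (λ t → + p ∣? v t)
  ... | yes p∣v = inj₂ p∣v
  ... | no  p∤v = inj₁ p∤v

  cross : Vecℤ 3 → Vecℤ 3 → Vecℤ 3
  cross α β = α 1F * β 2F - α 2F * β 1F ∷ α 2F * β 0F - α 0F * β 2F ∷ α 0F * β 1F - α 1F * β 0F ∷ []

  cross-⊥ˡ : ∀ α β → cross α β · α ≡ + 0
  cross-⊥ˡ α β = identity (α 0F) (α 1F) (α 2F) (β 0F) (β 1F) (β 2F)
    where
    identity : ∀ a₀ a₁ a₂ b₀ b₁ b₂ →
      (a₁ * b₂ - a₂ * b₁) * a₀ + ((a₂ * b₀ - a₀ * b₂) * a₁ + ((a₀ * b₁ - a₁ * b₀) * a₂ + + 0)) ≡ + 0
    identity = solve-∀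

  cross-⊥ʳ : ∀ α β → cross α β · β ≡ + 0
  cross-⊥ʳ α β = identity (α 0F) (α 1F) (α 2F) (β 0F) (β 1F) (β 2F)
    where
    identity : ∀ a₀ a₁ a₂ b₀ b₁ b₂ →
      (a₁ * b₂ - a₂ * b₁) * b₀ + ((a₂ * b₀ - a₀ * b₂) * b₁ + ((a₀ * b₁ - a₁ * b₀) * b₂ + + 0)) ≡ + 0
    identity = solve-∀

  perp : Vecℤ 3 → Fin 3 → Vecℤ 3
  perp α 0F = α 1F ∷ - α 0F ∷ + 0 ∷ []
  perp α 1F = + 0 ∷ α 2F ∷ - α 1F ∷ []
  perp α 2F = - α 2F ∷ + 0 ∷ α 0F ∷ []

  perp-⊥ : ∀ α t → perp α t · α ≡ + 0
  perp-⊥ α 0F = identity (α 0F) (α 1F) (α 2F)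
    where
    identity : ∀ a₀ a₁ a₂ → a₁ * a₀ + ((- a₀) * a₁ + (+ 0 * a₂ + + 0)) ≡ + 0
    identity = solve-∀
  perp-⊥ α 1F = identity (α 0F) (α 1F) (α 2F)
    where
    identity : ∀ a₀ a₁ a₂ → + 0 * a₀ + (a₂ * a₁ + ((- a₁) * a₂ + + 0)) ≡ + 0
    identity = solve-∀
  perp-⊥ α 2F = identity (α 0F) (α 1F) (α 2F)
    where
    identity : ∀ a₀ a₁ a₂ → (- a₂) * a₀ + (+ 0 * a₁ + (a₀ * a₂ + + 0)) ≡ + 0
    identity = solve-∀

  -- β · perp α t is, up to sign, an entry of cross α β.
  perp-·-cross : ∀ {d} α β t → (∀ s → d ∣ cross α β s) → d ∣ perp α t · β
  perp-·-cross α β 0F d∣cross = subst (_ ∣_) (identity (α 0F) (α 1F) (α 2F) (β 0F) (β 1F) (β 2F)) (∣m⇒∣-m (d∣cross 2F))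
    where
    identity : ∀ a₀ a₁ a₂ b₀ b₁ b₂ → - (a₀ * b₁ - a₁ * b₀) ≡ a₁ * b₀ + ((- a₀) * b₁ + (+ 0 * b₂ + + 0))
    identity = solve-∀
  perp-·-cross α β 1F d∣cross = subst (_ ∣_) (identity (α 0F) (α 1F) (α 2F) (β 0F) (β 1F) (β 2F)) (∣m⇒∣-m (d∣cross 0F))
    where
    identity : ∀ a₀ a₁ a₂ b₀ b₁ b₂ → - (a₁ * b₂ - a₂ * b₁) ≡ + 0 * b₀ + (a₂ * b₁ + ((- a₁) * b₂ + + 0))
    identity = solve-∀
  perp-·-cross α β 2F d∣cross = subst (_ ∣_) (identity (α 0F) (α 1F) (α 2F) (β 0F) (β 1F) (β 2F)) (∣m⇒∣-m (d∣cross 1F))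
    where
    identity : ∀ a₀ a₁ a₂ b₀ b₁ b₂ → - (a₂ * b₀ - a₀ * b₂) ≡ (- a₂) * b₀ + (+ 0 * b₁ + (a₀ * b₂ + + 0))
    identity = solve-∀

  perp-nonzero : ∀ {d} α t → ¬ d ∣ α t → ¬ (∀ s → d ∣ perp α t s)
  perp-nonzero α 0F d∤α d∣perp = d∤α (subst (_ ∣_) (neg-involutive (α 0F)) (∣m⇒∣-m (d∣perp 1F)))
  perp-nonzero α 1F d∤α d∣perp = d∤α (subst (_ ∣_) (neg-involutive (α 1F)) (∣m⇒∣-m (d∣perp 2F)))
  perp-nonzero α 2F d∤α d∣perp = d∤α (subst (_ ∣_) (neg-involutive (α 2F)) (∣m⇒∣-m (d∣perp 0F)))

  -- The cross product, unless it vanishes mod p; then α and β are proportional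
  -- mod p and a vector orthogonal to a nonzero one of them will do.
  common-nontrivial-zero : ∀ {p} → Prime p → (α β : Vecℤ 3) →
    Σ (Vecℤ 3) λ c → NonzeroMod p c × + p ∣ c · α × + p ∣ c · β
  common-nontrivial-zero {p} p-prime α β with nonzeroMod? p (cross α β) | nonzeroMod? p α | nonzeroMod? p β
  ... | inj₁ cross≢0 | _ | _ =
    cross α β , cross≢0 , divides (+ 0) (cross-⊥ˡ α β) , divides (+ 0) (cross-⊥ʳ α β)
  ... | inj₂ cross≡0 | inj₁ α≢0 | _ with ¬∀⟶∃¬ 3 _ (λ t → + p ∣? α t) α≢0
  ...   | t , p∤αt = perp α t , perp-nonzero α t p∤αt , divides (+ 0) (perp-⊥ α t) , perp-·-cross α β t cross≡0
  common-nontrivial-zero {p} p-prime α β | _ | inj₂ α≡0 | inj₁ β≢0 with ¬∀⟶∃¬ 3 _ (λ t → + p ∣? β t) β≢0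
  ...   | t , p∤βt = perp β t , perp-nonzero β t p∤βt , ∣-·ʳ (perp β t) α≡0 , divides (+ 0) (perp-⊥ β t)
  common-nontrivial-zero {p} p-prime α β | _ | inj₂ α≡0 | inj₂ β≡0 =
    one , (λ p∣1 → prime∤1 p-prime (p∣1 0F)) , ∣-·ʳ one α≡0 , ∣-·ʳ one β≡0
    where
    one : Vecℤ 3
    one _ = + 1

  InImage : ∀ {m n} → (Fin m → Fin n) → Fin n → Set
  InImage ρ j = ∃ λ a → ρ a ≡ j

  inImage? : ∀ {m n} (ρ : Fin m → Fin n) j → Dec (InImage ρ j)
  inImage? ρ j = any? (λ a → ρ a ≟ j)

  punchOut-avoiding : ∀ {m n} {ρ : Fin m → Fin (suc n)} {r} → Injective ρ → (r∉ρ : ∀ a → r ≢ ρ a) →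
    Injective (λ a → punchOut (r∉ρ a))
  punchOut-avoiding ρ-inj r∉ρ a b eq = ρ-inj a b (punchOut-injective (r∉ρ a) (r∉ρ b) eq)

  -- Avoiding two points would inject Fin m into Fin (m ∸ 1).
  injection-misses-one : ∀ {m} (ρ : Fin m → Fin (suc m)) → Injective ρ →
    Σ (Fin (suc m)) λ r → ∀ j → j ≢ r → InImage ρ j
  injection-misses-one {m} ρ ρ-inj with all? (inImage? ρ)
  ... | yes onto = zero , λ j _ → onto j
  ... | no  not-onto with ¬∀⟶∃¬ (suc m) (InImage ρ) (inImage? ρ) not-onto
  ...   | r , r∉ρ = r , hit
    where
    r∉ρ′ : ∀ a → r ≢ ρ a
    r∉ρ′ a r≡ρa = r∉ρ (a , sym r≡ρa)
    two-missing : ∀ {m} (σ : Fin m → Fin m) → Injective σ → ∀ j → (∀ a → j ≢ σ a) → ⊥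
    two-missing {zero}  σ σ-inj () _
    two-missing {suc m} σ σ-inj j j∉σ =
      ℕₚ.<-irrefl refl (injective⇒≤ (λ {a} {b} → punchOut-avoiding σ-inj j∉σ a b))
    hit : ∀ j → j ≢ r → InImage ρ j
    hit j j≢r with inImage? ρ j
    ... | yes j∈ρ = j∈ρ
    ... | no  j∉ρ = ⊥-elim (two-missing _ (punchOut-avoiding ρ-inj r∉ρ′) (punchOut (j≢r ∘ sym))
                     (λ a eq → j∉ρ (a , sym (punchOut-injective (j≢r ∘ sym) (r∉ρ′ a) eq))))

  Σℤ-restrict-image : ∀ {q m n} (ρ : Fin m → Fin n) → Injective ρ → (h : Fin n → ℤ) →
    (∀ j → ¬ InImage ρ j → + q ∣ h j) → + q ∣ Σℤ h - Σℤ (h ∘ ρ)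
  Σℤ-restrict-image {m = zero} ρ ρ-inj h q∣h = subst (_ ∣_) (sym (+-identityʳ (Σℤ h))) (∣-Σℤ (λ j → q∣h j (λ ())))
  Σℤ-restrict-image {m = suc m} {zero} ρ ρ-inj h q∣h with ρ zero
  ... | ()
  Σℤ-restrict-image {q} {suc m} {suc n} ρ ρ-inj h q∣h =
    subst (_ ∣_) peel (Σℤ-restrict-image ρ′ ρ′-inj (h ∘ punchIn r) q∣h′)
    where
    r = ρ zero
    r∉ρ : ∀ a → r ≢ ρ (suc a)
    r∉ρ a r≡ρa with ρ-inj zero (suc a) r≡ρa
    ... | ()
    ρ′ : Fin m → Fin n
    ρ′ a = punchOut (r∉ρ a)
    ρ′-inj : Injective ρ′
    ρ′-inj a b eq = suc-injective (ρ-inj (suc a) (suc b) (punchOut-injective (r∉ρ a) (r∉ρ b) eq))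
    q∣h′ : ∀ j → ¬ InImage ρ′ j → + q ∣ h (punchIn r j)
    q∣h′ j j∉ρ′ = q∣h (punchIn r j) λ
      { (zero , r≡) → punchInᵢ≢i r j (sym r≡)
      ; (suc a , ρa≡) → j∉ρ′ (a , trans (punchOut-cong r ρa≡) (punchOut-punchIn r)) }
    peel : Σℤ (h ∘ punchIn r) - Σℤ (h ∘ punchIn r ∘ ρ′) ≡ Σℤ h - Σℤ (h ∘ ρ)
    peel = sym (begin
      Σℤ h - Σℤ (h ∘ ρ)                                          ≡⟨ cong (_- Σℤ (h ∘ ρ)) (Σℤ-remove r h) ⟩
      h r + Σℤ (h ∘ punchIn r) - (h r + Σℤ (h ∘ ρ ∘ suc))       ≡⟨ cong (λ s → h r + Σℤ (h ∘ punchIn r) - (h r + s))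
                                                                       (Σℤ-cong (λ a → cong h (sym (punchIn-punchOut (r∉ρ a))))) ⟩
      h r + Σℤ (h ∘ punchIn r) - (h r + Σℤ (h ∘ punchIn r ∘ ρ′)) ≡⟨ cancel (h r) _ _ ⟩
      Σℤ (h ∘ punchIn r) - Σℤ (h ∘ punchIn r ∘ ρ′)               ∎)
      where
      open ≡-Reasoning
      cancel : ∀ x y z → x + y - (x + z) ≡ y - z
      cancel = solve-∀

  consecutive : ∀ {n d} (i : Fin n) → toℕ i ℕ.+ d ≡ n → Fin d → Fin n
  consecutive i i+d≡n t = fromℕ< (ℕₚ.<-≤-trans (ℕₚ.+-monoʳ-< (toℕ i) (toℕ<n t)) (ℕₚ.≤-reflexive i+d≡n))

  toℕ-consecutive : ∀ {n d} (i : Fin n) (i+d≡n : toℕ i ℕ.+ d ≡ n) t → toℕ (consecutive i i+d≡n t) ≡ toℕ i ℕ.+ toℕ t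
  toℕ-consecutive i i+d≡n t = toℕ-fromℕ< _

  consecutive-injective : ∀ {n d} (i : Fin n) (i+d≡n : toℕ i ℕ.+ d ≡ n) → Injective (consecutive i i+d≡n)
  consecutive-injective i i+d≡n a b eq = toℕ-injective (ℕₚ.+-cancelˡ-≡ (toℕ i) _ _
    (trans (sym (toℕ-consecutive i i+d≡n a)) (trans (cong toℕ eq) (toℕ-consecutive i i+d≡n b))))

  Diagonalises : ∀ {n} → Mat n → Mat n → Mat n → Vecℤ n → Set
  Diagonalises U M V f = ∀ i j → ((U ⊛ M) ⊛ V) i j ≡ diagMat f i j

  diagonalised-·v : ∀ {n} {U M V : Mat n} {f} → Diagonalises U M V f → ∀ y k →
    (U ·v (M ·v (V ·v y))) k ≡ f k * y k
  diagonalised-·v {U = U} {M} {V} {f} UMV≡f y k = begin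
    (U ·v (M ·v (V ·v y))) k       ≡⟨ sym (·v-assoc U M (V ·v y) k) ⟩
    ((U ⊛ M) ·v (V ·v y)) k        ≡⟨ sym (·v-assoc (U ⊛ M) V y k) ⟩
    (((U ⊛ M) ⊛ V) ·v y) k         ≡⟨ Σℤ-cong (λ j → cong (_* y j) (UMV≡f k j)) ⟩
    (diagMat f ·v y) k             ≡⟨ diagMat-·v f y k ⟩
    f k * y k                      ∎
    where open ≡-Reasoning

  diagonalised-rows : ∀ {n} {U M V : Mat (suc n)} {f} → Diagonalises U M V f → Unimodular V → ∀ k l →
    (U ⊛ M) k l ≡ f k * inverse V k l
  diagonalised-rows {U = U} {M} {V} {f} UMV≡f V-uni k l = begin
    (U ⊛ M) k l                                  ≡⟨ sym (Σℤ-idMatʳ l ((U ⊛ M) k)) ⟩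
    Σℤ (λ j → (U ⊛ M) k j * idMat j l)           ≡⟨ Σℤ-cong (λ j → cong ((U ⊛ M) k j *_)
                                                                   (sym (⊛-inverseʳ {V = V} V-uni j l))) ⟩
    ((U ⊛ M) ⊛ (V ⊛ inverse V)) k l              ≡⟨ sym (⊛-assoc (U ⊛ M) V (inverse V) k l) ⟩
    (((U ⊛ M) ⊛ V) ⊛ inverse V) k l              ≡⟨ Σℤ-cong (λ j → cong (_* inverse V j l) (UMV≡f k j)) ⟩
    (diagMat f ·v (λ j → inverse V j l)) k       ≡⟨ diagMat-·v f (λ j → inverse V j l) k ⟩
    f k * inverse V k l                          ∎
    where open ≡-Reasoning

  -- Row k of U M = diag(f) V⁻¹ is fₖ times row k of V⁻¹.
  diagonalised-kernel : ∀ {n d} {U M V : Mat (suc n)} {f} → (∀ i j → M i j ≡ M j i) →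
    Diagonalises U M V f → Unimodular V → ∀ k → d ∣ f k → ∀ l → d ∣ (M ·v U k) l
  diagonalised-kernel {U = U} {M} {V} {f} M-sym UMV≡f V-uni k d∣fk l =
    subst (_ ∣_) (sym (begin
      (M ·v U k) l                 ≡⟨ Σℤ-cong (λ j → trans (*-comm (M l j) (U k j)) (cong (U k j *_) (M-sym l j))) ⟩
      (U ⊛ M) k l                  ≡⟨ diagonalised-rows {U = U} {M} {V} UMV≡f V-uni k l ⟩
      f k * inverse V k l          ∎))
      (∣m⇒∣m*n (inverse V k l) d∣fk)
    where open ≡-Reasoning

  snf-divides : ∀ {n} (f : Vecℤ n) → (∀ (i j : Fin n) → toℕ j ≡ suc (toℕ i) → f i ℤᵘ.∣ f j) →
    ∀ {i j : Fin n} → toℕ i ℕ.≤ toℕ j → f i ∣ f j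
  snf-divides {n} f step {i} {j} i≤j = go (toℕ j ℕ.∸ toℕ i) (ℕₚ.m+[n∸m]≡n i≤j)
    where
    go : ∀ d {i j : Fin n} → toℕ i ℕ.+ d ≡ toℕ j → f i ∣ f j
    go zero    {i} {j} i+0≡j = ∣-reflexive (cong f (toℕ-injective (trans (sym (ℕₚ.+-identityʳ (toℕ i))) i+0≡j)))
    go (suc d) {i} {j} i+d≡j = ∣-trans (∣ᵤ⇒∣ (step i i⁺ (toℕ-fromℕ< i+1<n))) (go d i⁺+d≡j)
      where
      i+1<n : suc (toℕ i) ℕ.< n
      i+1<n = ℕₚ.≤-<-trans (ℕₚ.≤-trans (ℕₚ.m≤m+n (suc (toℕ i)) d)
                                        (ℕₚ.≤-reflexive (trans (sym (ℕₚ.+-suc (toℕ i) d)) i+d≡j)))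
                           (toℕ<n j)
      i⁺ : Fin n
      i⁺ = fromℕ< i+1<n
      i⁺+d≡j : toℕ i⁺ ℕ.+ d ≡ toℕ j
      i⁺+d≡j = trans (cong (ℕ._+ d) (toℕ-fromℕ< i+1<n)) (trans (sym (ℕₚ.+-suc (toℕ i) d)) i+d≡j)

  snf-last-divisible : ∀ {m p} {M : Mat (suc m)} {f} → Prime p → IsSmithNormalForm M f →
    ∀ τ (z : Vecℤ (suc m)) → NonzeroMod p z → (∀ i → + (p ℕ.^ τ) ∣ (M ·v z) i) →
    ∀ i → toℕ i ℕ.+ 1 ≡ suc m → + (p ℕ.^ τ) ∣ f i
  snf-last-divisible {m} {p} {M} {f} p-prime ((U , V , _ , V-uni , UMV≡f) , _ , f-step) τ z z≢0 q∣Mz i i-last =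
    ∣-trans pᵗ∣fk (snf-divides f f-step k≤i)
    where
    y : Vecℤ (suc m)
    y = inverse V ·v z
    Vy≡z : ∀ j → (V ·v y) j ≡ z j
    Vy≡z = ·v-inverse {V = V} V-uni z
    y≢0 : NonzeroMod p y
    y≢0 p∣y = z≢0 (λ j → subst (_ ∣_) (Vy≡z j) (∣-·v V p∣y j))
    unit-entry = ¬∀⟶∃¬ (suc m) _ (λ j → + p ∣? y j) y≢0
    k = proj₁ unit-entry
    q∣fy : + (p ℕ.^ τ) ∣ f k * y k
    q∣fy = subst (_ ∣_) (diagonalised-·v {U = U} {M} {V} UMV≡f y k)
      (∣-·v U (λ j → subst (_ ∣_) (Σℤ-cong (λ l → cong (M j l *_) (sym (Vy≡z l)))) (q∣Mz j)) k)
    pᵗ∣fk : + (p ℕ.^ τ) ∣ f k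
    pᵗ∣fk = prime-pow∣*⇒pow∣ℤ p-prime τ (f k) (y k) q∣fy (proj₂ unit-entry)
    k≤i : toℕ k ℕ.≤ toℕ i
    k≤i = ℕₚ.≤-trans (ℕₚ.≤-pred (toℕ<n k))
                     (ℕₚ.≤-reflexive (sym (ℕₚ.suc-injective (trans (ℕₚ.+-comm 1 (toℕ i)) i-last))))

  -- Since y is an eigenvector mod q, (Aᵗ e)ᵀ y ≡ λ₀ᵗ eᵀ y.
  walkMatrix-orthogonal : ∀ {n q} (A : Mat n) → (∀ i j → A i j ≡ A j i) → ∀ λ₀ (y : Vecℤ n) →
    (∀ k → + q ∣ (shift A λ₀ ·v y) k) → + q ∣ allOnes · y → ∀ m → + q ∣ (transpose (walkMatrix A) ·v y) m
  walkMatrix-orthogonal {q = q} A A-sym λ₀ y q∣My q∣ey m = powers (toℕ m)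
    where
    powers : ∀ t → + q ∣ powv A t allOnes · y
    powers zero    = q∣ey
    powers (suc t) = subst (_ ∣_) (sym (begin
      (A ·v u) · y                                             ≡⟨ ·v-symmetric A A-sym u y ⟩
      u · (A ·v y)                                             ≡⟨ Σℤ-cong (λ j → split (u j) (y j) (shift-·v A λ₀ y j)) ⟩
      Σℤ (λ j → u j * (shift A λ₀ ·v y) j + λ₀ * (u j * y j))
        ≡⟨ Σℤ-distrib-+ (λ j → u j * (shift A λ₀ ·v y) j) (λ j → λ₀ * (u j * y j)) ⟩
      u · (shift A λ₀ ·v y) + Σℤ (λ j → λ₀ * (u j * y j))
        ≡⟨ cong (_+_ (u · (shift A λ₀ ·v y))) (sym (*-distribˡ-Σℤ λ₀ (λ j → u j * y j))) ⟩
      u · (shift A λ₀ ·v y) + λ₀ * (u · y)                     ∎))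
      (∣m∣n⇒∣m+n (∣-·ʳ u q∣My) (∣n⇒∣m*n λ₀ (powers t)))
      where
      open ≡-Reasoning
      u = powv A t allOnes
      split : ∀ {a m} x y → m ≡ a - λ₀ * y → x * a ≡ x * m + λ₀ * (x * y)
      split {a} {m} x y m≡a-λ₀y = trans (identity x a λ₀ y) (cong (λ v → x * v + λ₀ * (x * y)) (sym m≡a-λ₀y))
        where
        identity : ∀ x a l y → x * a ≡ x * (a - l * y) + l * (x * y)
        identity = solve-∀

  -- Off the image of ρ only row r survives, so Wᵀ y ≡ 0 restricts to a row
  -- relation for the nonsingular minor.
  minor-kernel : ∀ {m p} → Prime p → (W : Mat (suc m)) (ρ κ : Fin m → Fin (suc m)) → Injective ρ →
    ¬ + p ∣ det (minor W ρ κ) → ∀ r → (∀ j → j ≢ r → InImage ρ j) →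
    (y : Vecℤ (suc m)) → (∀ b → + p ∣ (transpose W ·v y) b) → + p ∣ y r → ∀ j → + p ∣ y j
  minor-kernel {m} {p} p-prime W ρ κ ρ-inj p∤det r hit y p∣Wᵀy p∣yr j with j ≟ r
  ... | yes refl = p∣yr
  ... | no  j≢r  with hit j j≢r
  ...   | a , refl = rows-independent p-prime (minor W ρ κ) p∤det (y ∘ ρ) relation a
    where
    relation : ∀ b → + p ∣ Σℤ (λ a → y (ρ a) * W (ρ a) (κ b))
    relation b = subst (_ ∣_) image-part (∣m∣n⇒∣m-n (p∣Wᵀy (κ b)) (Σℤ-restrict-image ρ ρ-inj h off-image))
      where
      h : Fin (suc m) → ℤ
      h j = W j (κ b) * y j
      cancel : ∀ x z → x - (x - z) ≡ z
      cancel = solve-∀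
      image-part : Σℤ h - (Σℤ h - Σℤ (h ∘ ρ)) ≡ Σℤ (λ a → y (ρ a) * W (ρ a) (κ b))
      image-part = trans (cancel (Σℤ h) (Σℤ (h ∘ ρ))) (Σℤ-cong (λ a → *-comm (W (ρ a) (κ b)) (y (ρ a))))
      off-image : ∀ j → ¬ InImage ρ j → + p ∣ W j (κ b) * y j
      off-image j j∉ρ with j ≟ r
      ... | yes refl = ∣n⇒∣m*n (W r (κ b)) p∣yr
      ... | no  j≢r  = ⊥-elim (j∉ρ (hit j j≢r))

  no-three-kernel-rows : ∀ {m p} (A : Mat (suc m)) → (∀ i j → A i j ≡ A j i) → ∀ λ₀ → Prime p →
    (ρ κ : Fin m → Fin (suc m)) → Injective ρ → ¬ + p ∣ det (minor (walkMatrix A) ρ κ) →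
    (U : Mat (suc m)) → Unimodular U → (ι : Fin 3 → Fin (suc m)) → Injective ι →
    (∀ t l → + p ∣ (shift A λ₀ ·v U (ι t)) l) → ⊥
  no-three-kernel-rows {m} {p} A A-sym λ₀ p-prime ρ κ ρ-inj p∤det U U-uni ι ι-inj p∣MU =
    c≢0 (λ s → subst (_ ∣_) (ĉ-at s) (p∣ĉ (ι s)))
    where
    r = proj₁ (injection-misses-one ρ ρ-inj)
    hit = proj₂ (injection-misses-one ρ ρ-inj)
    α β : Vecℤ 3
    α t = allOnes · U (ι t)
    β t = U (ι t) r
    common-zero = common-nontrivial-zero p-prime α β
    c = proj₁ common-zero
    c≢0 = proj₁ (proj₂ common-zero)
    p∣c·α = proj₁ (proj₂ (proj₂ common-zero))
    p∣c·β = proj₂ (proj₂ (proj₂ common-zero))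
    y : Vecℤ (suc m)
    y = combination c (U ∘ ι)
    p∣My : ∀ l → + p ∣ (shift A λ₀ ·v y) l
    p∣My l = subst (_ ∣_) (sym (·-combination (shift A λ₀ l) c (U ∘ ι))) (∣-·ʳ c (λ t → p∣MU t l))
    p∣ey : + p ∣ allOnes · y
    p∣ey = subst (_ ∣_) (sym (·-combination allOnes c (U ∘ ι))) p∣c·α
    p∣y : ∀ j → + p ∣ y j
    p∣y = minor-kernel p-prime (walkMatrix A) ρ κ ρ-inj p∤det r hit y
            (walkMatrix-orthogonal A A-sym λ₀ y p∣My p∣ey) p∣c·β
    ĉ : Vecℤ (suc m)
    ĉ = combination c (λ t a → idMat (ι t) a)
    ĉU≡y : ∀ l → ĉ · (λ a → U a l) ≡ y l
    ĉU≡y l = begin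
      ĉ · (λ a → U a l)                                 ≡⟨ ·-comm ĉ (λ a → U a l) ⟩
      (λ a → U a l) · ĉ                                 ≡⟨ ·-combination (λ a → U a l) c (λ t a → idMat (ι t) a) ⟩
      c · (λ t → (λ a → U a l) · (λ a → idMat (ι t) a)) ≡⟨ Σℤ-cong (λ t → cong (c t *_) (row-of-U t)) ⟩
      y l                                               ∎
      where
      open ≡-Reasoning
      row-of-U : ∀ t → (λ a → U a l) · (λ a → idMat (ι t) a) ≡ U (ι t) l
      row-of-U t = trans (·-comm (λ a → U a l) (λ a → idMat (ι t) a)) (Σℤ-idMatˡ (ι t) (λ a → U a l))
    p∣ĉ : ∀ a → + p ∣ ĉ a
    p∣ĉ = rows-independent p-prime U (prime∤unimodular {V = U} p-prime U-uni) ĉ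
      (λ l → subst (_ ∣_) (sym (ĉU≡y l)) (p∣y l))
    ĉ-at : ∀ s → ĉ (ι s) ≡ c s
    ĉ-at s = trans (Σℤ-cong (λ t → cong (c t *_) (idMat-injective ι-inj t s))) (Σℤ-idMatʳ s c)

  snf-third-last-coprime : ∀ {m p} (A : Mat (suc m)) → (∀ i j → A i j ≡ A j i) → ∀ λ₀ → Prime p →
    (ρ κ : Fin m → Fin (suc m)) → Injective ρ → ¬ + p ∣ det (minor (walkMatrix A) ρ κ) →
    ∀ {f} → IsSmithNormalForm (shift A λ₀) f → ∀ i → toℕ i ℕ.+ 3 ≡ suc m → ¬ + p ∣ f i
  snf-third-last-coprime {p = p} A A-sym λ₀ p-prime ρ κ ρ-inj p∤det {f}
                         ((U , V , U-uni , V-uni , UMV≡f) , _ , f-step) i i+3≡n p∣fi =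
    no-three-kernel-rows A A-sym λ₀ p-prime ρ κ ρ-inj p∤det U U-uni ι (consecutive-injective i i+3≡n) p∣MU
    where
    ι = consecutive i i+3≡n
    p∣MU : ∀ t l → + p ∣ (shift A λ₀ ·v U (ι t)) l
    p∣MU t = diagonalised-kernel {U = U} {shift A λ₀} {V} (shift-sym A λ₀ A-sym) UMV≡f V-uni (ι t)
      (∣-trans p∣fi (snf-divides f f-step i≤ιt))
      where
      i≤ιt : toℕ i ℕ.≤ toℕ (ι t)
      i≤ιt = ℕₚ.≤-trans (ℕₚ.m≤m+n (toℕ i) (toℕ t)) (ℕₚ.≤-reflexive (sym (toℕ-consecutive i i+3≡n t)))

open import Data.Nat using (ℕ; zero; suc; _+_; _*_; _^_; _≤_; _∸_)
open import Data.Integer using (ℤ; +_; _-_)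

lemma3p4 : (n : ℕ) (A : Mat n) → IsAdjacency A → Controllable A →
    (p : ℕ) → Prime p → ¬ (p ≡ 2) → p ∣ℤ det (walkMatrix A) →
    RankModP p (walkMatrix A) (n ∸ 1) →
    (L τ : ℕ) → IsLcmLevels A L → Valuation p L τ → 1 ≤ τ →
    (z₀ : Vecℤ n) (λ₀ : ℤ) →
    ¬ (∀ i → p ∣ℤ z₀ i) →
    (p ^ (2 * τ)) ∣ℤ Σℤ (λ i → z₀ i Data.Integer.* z₀ i) →
    (p ^ (2 * τ)) ∣ℤ Σℤ (λ i → z₀ i Data.Integer.* (A ·v z₀) i) →
    (∀ i → (p ^ τ) ∣ℤ (transpose (walkMatrix A) ·v z₀) i) →
    (∀ i → (p ^ τ) ∣ℤ ((A ·v z₀) i - λ₀ Data.Integer.* z₀ i)) →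
    (f : Vecℤ n) → IsSmithNormalForm (shift A λ₀) f →
    (∀ (i : Fin n) → toℕ i + 3 ≡ n → ¬ (p ∣ℤ f i)) ×
    (∀ (i : Fin n) → toℕ i + 1 ≡ n → (p ^ τ) ∣ℤ f i)
-- Only the symmetry of A, rank_p W ≥ n - 1, z₀ ≢ 0 and A z₀ ≡ λ₀ z₀ (mod p^τ) are used;
-- the other hypotheses belong to the setting of the paper.
lemma3p4 zero _ _ _ _ _ _ _ _ _ _ _ _ _ _ _ _ _ _ _ _ _ _ = (λ ()) , (λ ())
lemma3p4 (suc m) A (_ , A-sym , _) _ p p-prime _ _ ((ρ , κ , ρ-inj , _ , p∤det) , _) _ τ _ _ _
         z₀ λ₀ z₀≢0 _ _ _ Az₀≡λ₀z₀ f snf =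
  (λ i i+3≡n p∣fi →
     snf-third-last-coprime A A-sym λ₀ p-prime ρ κ ρ-inj (p∤det ∘ ∣⇒∣ᵤ) snf i i+3≡n (∣ᵤ⇒∣ p∣fi)) ,
  (λ i i+1≡n → ∣⇒∣ᵤ (snf-last-divisible {M = shift A λ₀} p-prime snf τ z₀ z₀≢0′ pᵗ∣Mz₀ i i+1≡n))
  where
  z₀≢0′ : NonzeroMod p z₀
  z₀≢0′ p∣z₀ = z₀≢0 (∣⇒∣ᵤ ∘ p∣z₀)
  pᵗ∣Mz₀ : ∀ i → + (p ^ τ) ∣ (shift A λ₀ ·v z₀) i
  pᵗ∣Mz₀ i = subst (_ ∣_) (sym (shift-·v A λ₀ z₀ i)) (∣ᵤ⇒∣ (Az₀≡λ₀z₀ i))
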